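{- Let $l$ and $n$ be integers with $l\geq 3$ and $n\geq 2l+3$, and assume that $l\geq 5$ or $n\geq 15$. Let $k=\lceil n/2\rceil$. Then \[(n-l)\left\lceil\frac{n-l+1}{2}\right\rceil-1\leq\max\left\{3+\sum_{i=1}^l\frac{1}{i+1}\binom{2i}{i},\ (1+(l-1)(n-k))\left(\left\lceil\frac1k\binom{k}{l}\right\rceil-l+2\right)\right\}.\] -}

module Defs where

open import Data.Nat as ℕ using (ℕ; suc; zero)
open import Data.Nat.Combinatorics using (_C_)
open import Data.Integer as ℤ using (ℤ; +_)
open import Data.Rational as ℚ using (ℚ; _/_; ceiling; _⊔_)

ι : ℤ → ℚ
ι z = z / 1

catSum : ℕ → ℚ
catSum zero    = ℚ.0ℚ
catSum (suc i) = catSum i ℚ.+ (+ ((2 ℕ.* suc i) C suc i) / suc (suc i))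

halfCeil : ℕ → ℕ
halfCeil n = ℤ.∣ ceiling (+ n / 2) ∣

lhs : ℕ → ℕ → ℚ
lhs n l = ι ((+ n ℤ.- + l) ℤ.* ceiling ((+ n ℤ.- + l ℤ.+ ℤ.1ℤ) / 2) ℤ.- ℤ.1ℤ)

rhs : (n l k : ℕ) → .{{ℕ.NonZero k}} → ℚ
rhs n l k =
  (ι (+ 3) ℚ.+ catSum l)
  ⊔ ι ((ℤ.1ℤ ℤ.+ (+ l ℤ.- ℤ.1ℤ) ℤ.* (+ n ℤ.- + k))
       ℤ.* (ceiling (+ (k C l) / k) ℤ.- + l ℤ.+ + 2))

-- Put m = n − l and k = ⌈n/2⌉. Since 2⌈(m+1)/2⌉ ≤ m + 2 the left side is at most m(m+2)/2 − 1,
-- and n ≥ 2l + 3 forces k ≥ l + 2.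
-- If k = l + 2, then l ≥ 5 and m ≤ l + 4. From binom(2i+2,i+1) ≥ 2 binom(2i,i), induction from
-- i = 6 gives (i+1)(i+5) ≤ binom(2i,i): the i-th Catalan number is at least i + 5 for i ≥ 6.
-- Summing, the Catalan sum up to l is at least binom(l+6,2), and the first term of the maximum wins.
-- If k ≥ l + 3, unimodality gives binom(k,l) ≥ binom(k,3), so ⌈binom(k,l)/k⌉ ≥ (k−1)(k−2)/6,
-- and the second term wins by a polynomial inequality in l, k and n − k ∈ {k − 1, k}.

module Submission where

open import Defs
open import Data.Nat as ℕ using (ℕ; _≤_; _+_; _*_; NonZero)
open import Data.Sum using (_⊎_)
open import Relation.Binary.PropositionalEquality using (_≡_)
open import Data.Rational as ℚ using (ℚ)

open import Data.Integer as ℤ using (ℤ; +_; -[1+_])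
import Data.Integer.DivMod as ℤ
import Data.Integer.Properties as ℤ
import Data.Integer.Tactic.RingSolver as ℤ-Solver
open import Data.Nat using (zero; suc; _<_; _∸_; z≤n; s≤s; _≤?_)
open import Data.Nat.Combinatorics using (_C_; nCk+nC[k+1]≡[n+1]C[k+1]; nC1≡n)
open import Data.Nat.GCD using (gcd; gcd[m,n]≢0)
open import Data.Nat.Properties
open import Data.Nat.Tactic.RingSolver using (solve-∀)
open import Data.Product using (∃-syntax; _×_; _,_; proj₁; proj₂)
open import Data.Rational using (mkℚ; ceiling; floor; _/_; ↥_; ↧_; ↧ₙ_)
import Data.Rational.Properties as ℚ
open import Data.Rational.Unnormalised as ℚᵘ using (mkℚᵘ; *≤*; *≡*)
import Data.Rational.Unnormalised.Properties as ℚᵘ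
open import Data.Sum using (inj₁; inj₂; map₁; map₂; [_,_]′)
open import Function using (id)
open import Relation.Binary.PropositionalEquality
open import Relation.Nullary.Decidable using (from-yes)

floor-bounds : ∀ q → ∃[ r ] r < ↧ₙ q × ↥ q ≡ + r ℤ.+ floor q ℤ.* ↧ q
floor-bounds (mkℚ n d-1 _) = _ , ℤ.n%d<d n (+ suc d-1) , ℤ.a≡a%n+[a/n]*n n (+ suc d-1)

ceiling-bounds : ∀ p → ∃[ r ] r < ↧ₙ p × ceiling p ℤ.* ↧ p ≡ ↥ p ℤ.+ + r
ceiling-bounds p@record{} with floor-bounds (ℚ.- p)
... | r , r<↧ , ↥-p≡ = r , subst (r <_) (cong ℤ.∣_∣ (ℚ.↧-neg p)) r<↧ , (begin
    ceiling p ℤ.* ↧ p                                   ≡⟨ cong (ℤ.- f ℤ.*_) (sym (ℚ.↧-neg p)) ⟩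
    ℤ.- f ℤ.* ↧ (ℚ.- p)                                 ≡⟨ negate (+ r) f (↧ (ℚ.- p)) ⟩
    ℤ.- (+ r ℤ.+ f ℤ.* ↧ (ℚ.- p)) ℤ.+ + r               ≡⟨ cong (λ x → ℤ.- x ℤ.+ + r) (sym ↥-p≡) ⟩
    ℤ.- ↥ (ℚ.- p) ℤ.+ + r                               ≡⟨ cong (λ x → ℤ.- x ℤ.+ + r) (ℚ.↥-neg p) ⟩
    ℤ.- ℤ.- ↥ p ℤ.+ + r                                 ≡⟨ cong (ℤ._+ + r) (ℤ.neg-involutive (↥ p)) ⟩
    ↥ p ℤ.+ + r                                         ∎)
  where
  open ≡-Reasoning
  f : ℤ
  f = floor (ℚ.- p)
  negate : ∀ r f d → ℤ.- f ℤ.* d ≡ ℤ.- (r ℤ.+ f ℤ.* d) ℤ.+ r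
  negate = ℤ-Solver.solve-∀

i*+d≡+x⇒i≡+n : ∀ c d x .{{_ : NonZero d}} → c ℤ.* + d ≡ + x → ∃[ n ] c ≡ + n × n * d ≡ x
i*+d≡+x⇒i≡+n (+ n)     d       x eq = n , refl , ℤ.+-injective (trans (ℤ.pos-* n d) eq)
i*+d≡+x⇒i≡+n -[1+ n ] (suc d) x ()

ceiling-/ : ∀ a d .{{_ : NonZero d}} → ∃[ c ] ceiling (+ a / d) ≡ + c × a ≤ c * d × c * d < a + d
ceiling-/ a d = bounds (ceiling-bounds p)
  where
  open ≡-Reasoning
  p : ℚ
  p = + a / d
  g : ℕ
  g = gcd a d
  instance
    g≢0 : NonZero g
    g≢0 = ℕ.≢-nonZero (gcd[m,n]≢0 a d (inj₂ (ℕ.≢-nonZero⁻¹ d)))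
  ↧ₙg≡d : ↧ₙ p * g ≡ d
  ↧ₙg≡d = ℤ.+-injective (trans (ℤ.pos-* (↧ₙ p) g) (ℚ.↧-/ (+ a) d))
  bounds : ∃[ r ] r < ↧ₙ p × ceiling p ℤ.* ↧ p ≡ ↥ p ℤ.+ + r →
           ∃[ c ] ceiling p ≡ + c × a ≤ c * d × c * d < a + d
  bounds (r , r<↧ , c↧≡) with i*+d≡+x⇒i≡+n (ceiling p) d (a + r * g) cd≡
    where
    cd≡ : ceiling p ℤ.* + d ≡ + (a + r * g)
    cd≡ = begin
      ceiling p ℤ.* + d                ≡⟨ cong (ceiling p ℤ.*_) (sym (ℚ.↧-/ (+ a) d)) ⟩
      ceiling p ℤ.* (↧ p ℤ.* + g)      ≡⟨ sym (ℤ.*-assoc (ceiling p) (↧ p) (+ g)) ⟩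
      ceiling p ℤ.* ↧ p ℤ.* + g        ≡⟨ cong (ℤ._* + g) c↧≡ ⟩
      (↥ p ℤ.+ + r) ℤ.* + g            ≡⟨ ℤ.*-distribʳ-+ (+ g) (↥ p) (+ r) ⟩
      ↥ p ℤ.* + g ℤ.+ + r ℤ.* + g      ≡⟨ cong₂ ℤ._+_ (ℚ.↥-/ (+ a) d) (sym (ℤ.pos-* r g)) ⟩
      + (a + r * g)                    ∎
  ... | c , c≡ , cd≡a+rg = c , c≡ , subst (a ≤_) (sym cd≡a+rg) (m≤m+n a (r * g))
                               , subst (_< a + d) (sym cd≡a+rg) (+-monoʳ-< a (subst (r * g <_) ↧ₙg≡d (*-monoˡ-< g r<↧)))

c*2<a+2⇒2*c≤1+a : ∀ {a c} → c * 2 < a + 2 → 2 * c ≤ suc a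
c*2<a+2⇒2*c≤1+a {a} {c} c*2<a+2 = subst (_≤ suc a) (*-comm c 2) (≤-pred (subst (suc (c * 2) ≤_) (+-comm a 2) c*2<a+2))

halfCeil-bounds : ∀ {n k} → k ≡ halfCeil n → n ≤ 2 * k × 2 * k ≤ suc n
halfCeil-bounds {n} {k} k≡ = bounds (ceiling-/ n 2)
  where
  bounds : ∃[ c ] ceiling (+ n / 2) ≡ + c × n ≤ c * 2 × c * 2 < n + 2 → n ≤ 2 * k × 2 * k ≤ suc n
  bounds (c , ceiling≡c , n≤c*2 , c*2<n+2) =
    subst (λ k → n ≤ 2 * k × 2 * k ≤ suc n) (sym (trans k≡ (cong ℤ.∣_∣ ceiling≡c)))
      (subst (n ≤_) (*-comm c 2) n≤c*2 , c*2<a+2⇒2*c≤1+a {c = c} c*2<n+2)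

+[m+n]-+m≡+n : ∀ m n → + (m + n) ℤ.- + m ≡ + n
+[m+n]-+m≡+n m n = cancel (+ m) (+ n)
  where
  cancel : ∀ i j → i ℤ.+ j ℤ.- i ≡ j
  cancel = ℤ-Solver.solve-∀

ι≤/ : ∀ z i d .{{_ : NonZero d}} → z ℤ.* + d ℤ.≤ i → ι z ℚ.≤ i / d
ι≤/ z i (suc d) z*d≤i = ℚ.toℚᵘ-cancel-≤
  (ℚᵘ.≤-respˡ-≃ (ℚᵘ.≃-sym (ℚ.toℚᵘ-fromℚᵘ (mkℚᵘ z 0)))
  (ℚᵘ.≤-respʳ-≃ (ℚᵘ.≃-sym (ℚ.toℚᵘ-fromℚᵘ (mkℚᵘ i d)))
  (*≤* (subst (z ℤ.* + suc d ℤ.≤_) (sym (ℤ.*-identityʳ i)) z*d≤i))))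

ι-mono-≤ : ∀ {z w} → z ℤ.≤ w → ι z ℚ.≤ ι w
ι-mono-≤ {z} {w} z≤w = ι≤/ z w 1 (subst (ℤ._≤ _) (sym (ℤ.*-identityʳ z)) z≤w)

ι-homo-+ : ∀ z w → ι (z ℤ.+ w) ≡ ι z ℚ.+ ι w
ι-homo-+ z w = ℚ.toℚᵘ-injective (begin
  ℚ.toℚᵘ (ι (z ℤ.+ w))                  ≈⟨ ℚ.toℚᵘ-fromℚᵘ (mkℚᵘ (z ℤ.+ w) 0) ⟩
  mkℚᵘ (z ℤ.+ w) 0                       ≈⟨ *≡* (sum≡ z w) ⟩
  mkℚᵘ z 0 ℚᵘ.+ mkℚᵘ w 0                 ≈⟨ ℚᵘ.+-cong (ℚᵘ.≃-sym (ℚ.toℚᵘ-fromℚᵘ (mkℚᵘ z 0))) (ℚᵘ.≃-sym (ℚ.toℚᵘ-fromℚᵘ (mkℚᵘ w 0))) ⟩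
  ℚ.toℚᵘ (ι z) ℚᵘ.+ ℚ.toℚᵘ (ι w)         ≈⟨ ℚᵘ.≃-sym (ℚ.toℚᵘ-homo-+ (ι z) (ι w)) ⟩
  ℚ.toℚᵘ (ι z ℚ.+ ι w)                   ∎)
  where
  open ℚᵘ.≃-Reasoning
  sum≡ : ∀ z w → (z ℤ.+ w) ℤ.* + 1 ≡ (z ℤ.* + 1 ℤ.+ w ℤ.* + 1) ℤ.* + 1
  sum≡ = ℤ-Solver.solve-∀

pascal : ∀ n k → suc n C suc k ≡ n C k + n C suc k
pascal n k = sym (nCk+nC[k+1]≡[n+1]C[k+1] n k)

2*[1+n]C2≡[1+n]*n : ∀ n → 2 * (suc n C 2) ≡ suc n * n
2*[1+n]C2≡[1+n]*n zero    = refl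
2*[1+n]C2≡[1+n]*n (suc n) = begin
  2 * ((2 + n) C 2)                 ≡⟨ cong (2 *_) (pascal (suc n) 1) ⟩
  2 * (suc n C 1 + suc n C 2)       ≡⟨ cong (λ x → 2 * (x + suc n C 2)) (nC1≡n (suc n)) ⟩
  2 * (suc n + suc n C 2)           ≡⟨ *-distribˡ-+ 2 (suc n) (suc n C 2) ⟩
  2 * suc n + 2 * (suc n C 2)       ≡⟨ cong (_+_ (2 * suc n)) (2*[1+n]C2≡[1+n]*n n) ⟩
  2 * suc n + suc n * n             ≡⟨ regroup n ⟩
  (2 + n) * suc n                   ∎
  where
  open ≡-Reasoning
  regroup : ∀ n → 2 * suc n + suc n * n ≡ (2 + n) * suc n
  regroup = solve-∀

6*[2+n]C3≡[2+n]*[1+n]*n : ∀ n → 6 * ((2 + n) C 3) ≡ (2 + n) * (1 + n) * n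
6*[2+n]C3≡[2+n]*[1+n]*n zero    = refl
6*[2+n]C3≡[2+n]*[1+n]*n (suc n) = begin
  6 * ((3 + n) C 3)                               ≡⟨ cong (6 *_) (pascal (2 + n) 2) ⟩
  6 * ((2 + n) C 2 + (2 + n) C 3)                 ≡⟨ *-distribˡ-+ 6 ((2 + n) C 2) _ ⟩
  6 * ((2 + n) C 2) + 6 * ((2 + n) C 3)           ≡⟨ cong₂ _+_ (6*≡3*2* ((2 + n) C 2)) (6*[2+n]C3≡[2+n]*[1+n]*n n) ⟩
  3 * (2 * ((2 + n) C 2)) + (2 + n) * (1 + n) * n ≡⟨ cong (λ x → 3 * x + (2 + n) * (1 + n) * n) (2*[1+n]C2≡[1+n]*n (suc n)) ⟩
  3 * ((2 + n) * (1 + n)) + (2 + n) * (1 + n) * n ≡⟨ factor n ⟩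
  (3 + n) * (2 + n) * (1 + n)                     ∎
  where
  open ≡-Reasoning
  6*≡3*2* : ∀ x → 6 * x ≡ 3 * (2 * x)
  6*≡3*2* = solve-∀
  factor : ∀ n → 3 * ((2 + n) * (1 + n)) + (2 + n) * (1 + n) * n ≡ (3 + n) * (2 + n) * (1 + n)
  factor = solve-∀

k≤n⇒nCk>0 : ∀ {n k} → k ≤ n → 0 < n C k
k≤n⇒nCk>0 {n}     {zero}  _         = s≤s z≤n
k≤n⇒nCk>0 {suc n} {suc k} (s≤s k≤n) =
  <-≤-trans (k≤n⇒nCk>0 k≤n) (subst (n C k ≤_) (sym (pascal n k)) (m≤m+n (n C k) (n C suc k)))

nCs≤nC[s+a] : ∀ {n} s a → s + (s + a) ≤ n → n C s ≤ n C (s + a)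
nCs≤nC[s+a] {n}     zero    a       a≤n = k≤n⇒nCk>0 a≤n
nCs≤nC[s+a] {n}     (suc s) zero    _   = ≤-reflexive (cong (n C_) (sym (+-identityʳ (suc s))))
nCs≤nC[s+a] {suc n} (suc s) (suc a) (s≤s 2s+a+2≤n) = begin
  suc n C suc s                         ≡⟨ pascal n s ⟩
  n C s + n C suc s                     ≤⟨ +-mono-≤ (nCs≤nC[s+a] s (2 + a) (subst (_≤ n) (sym (shift₁ s a)) 2s+a+2≤n))
                                                    (nCs≤nC[s+a] (suc s) a (subst (_≤ n) (sym (shift₂ s a)) 2s+a+2≤n)) ⟩
  n C (s + (2 + a)) + n C (suc s + a)   ≡⟨ +-comm (n C (s + (2 + a))) _ ⟩
  n C (suc s + a) + n C (s + (2 + a))   ≡⟨ cong₂ (λ i j → n C i + n C j) (sym (+-suc s a)) (+-suc s (suc a)) ⟩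
  n C (s + suc a) + n C suc (s + suc a) ≡⟨ pascal n (s + suc a) ⟨
  suc n C (suc s + suc a)               ∎
  where
  open ≤-Reasoning
  shift₁ : ∀ s a → s + (s + (2 + a)) ≡ s + (suc s + suc a)
  shift₁ = solve-∀
  shift₂ : ∀ s a → suc s + (suc s + a) ≡ s + (suc s + suc a)
  shift₂ = solve-∀

2*nC[1+k]≤[2+n]C[2+k] : ∀ n k → 2 * (n C suc k) ≤ (2 + n) C (2 + k)
2*nC[1+k]≤[2+n]C[2+k] n k = begin
  2 * (n C suc k)                                     ≡⟨ cong (_+_ (n C suc k)) (+-identityʳ (n C suc k)) ⟩
  n C suc k + n C suc k                               ≤⟨ +-mono-≤ (m≤n+m _ (n C k)) (m≤m+n _ (n C (2 + k))) ⟩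
  (n C k + n C suc k) + (n C suc k + n C (2 + k))     ≡⟨ cong₂ _+_ (pascal n k) (pascal n (suc k)) ⟨
  suc n C suc k + suc n C (2 + k)                     ≡⟨ pascal (suc n) (suc k) ⟨
  (2 + n) C (2 + k)                                   ∎
  where open ≤-Reasoning

[7+t]*[11+t]≤[12+2t]C[6+t] : ∀ t → (7 + t) * (11 + t) ≤ (2 * (6 + t)) C (6 + t)
[7+t]*[11+t]≤[12+2t]C[6+t] zero    = from-yes (77 ≤? 12 C 6)
[7+t]*[11+t]≤[12+2t]C[6+t] (suc t) = begin
  (8 + t) * (12 + t)                 ≤⟨ m≤m+n _ (t * t + 16 * t + 58) ⟩
  (8 + t) * (12 + t) + (t * t + 16 * t + 58) ≡⟨ slack t ⟩
  2 * ((7 + t) * (11 + t))           ≤⟨ *-monoʳ-≤ 2 ([7+t]*[11+t]≤[12+2t]C[6+t] t) ⟩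
  2 * ((2 * (6 + t)) C (6 + t))      ≤⟨ 2*nC[1+k]≤[2+n]C[2+k] (2 * (6 + t)) (5 + t) ⟩
  (2 + 2 * (6 + t)) C (7 + t)        ≡⟨ cong (_C (7 + t)) (double t) ⟩
  (2 * (7 + t)) C (7 + t)            ∎
  where
  open ≤-Reasoning
  slack : ∀ t → (8 + t) * (12 + t) + (t * t + 16 * t + 58) ≡ 2 * ((7 + t) * (11 + t))
  slack = solve-∀
  double : ∀ t → 2 + 2 * (6 + t) ≡ 2 * (7 + t)
  double = solve-∀

catalan-term-lower-bound : ∀ t → ι (+ (11 + t)) ℚ.≤ + ((2 * (6 + t)) C (6 + t)) / (7 + t)
catalan-term-lower-bound t = ι≤/ (+ (11 + t)) (+ central) (7 + t)
  (subst (ℤ._≤ + central) (ℤ.pos-* (11 + t) (7 + t))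
    (ℤ.+≤+ (subst (_≤ central) (*-comm (7 + t) (11 + t)) ([7+t]*[11+t]≤[12+2t]C[6+t] t))))
  where
  central : ℕ
  central = (2 * (6 + t)) C (6 + t)

catSum-lower-bound : ∀ t → ι (+ ((11 + t) C 2)) ℚ.≤ catSum (5 + t)
catSum-lower-bound zero    = from-yes (ι (+ 55) ℚ.≤? catSum 5)
catSum-lower-bound (suc t) = begin
  ι (+ ((12 + t) C 2))                              ≡⟨ cong ι∘+ (pascal (11 + t) 1) ⟩
  ι (+ ((11 + t) C 1 + (11 + t) C 2))               ≡⟨ cong (λ x → ι (+ (x + (11 + t) C 2))) (nC1≡n (11 + t)) ⟩
  ι (+ (11 + t + (11 + t) C 2))                     ≡⟨ cong ι∘+ (+-comm (11 + t) _) ⟩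
  ι (+ ((11 + t) C 2) ℤ.+ + (11 + t))               ≡⟨ ι-homo-+ (+ ((11 + t) C 2)) (+ (11 + t)) ⟩
  ι (+ ((11 + t) C 2)) ℚ.+ ι (+ (11 + t))           ≤⟨ ℚ.+-mono-≤ (catSum-lower-bound t) (catalan-term-lower-bound t) ⟩
  catSum (6 + t)                                    ∎
  where
  open ℚ.≤-Reasoning
  ι∘+ : ℕ → ℚ
  ι∘+ x = ι (+ x)

lhs≤ι : ∀ l m z {n} → l + m ≡ n → m * (m + 2) ≤ 2 * suc z → lhs n l ℚ.≤ ι (+ z)
lhs≤ι l m z refl m[m+2]≤2[1+z] = ι-mono-≤ (bounds (ceiling-/ (m + 1) 2))
  where
  bounds : ∃[ c ] ceiling (+ (m + 1) / 2) ≡ + c × m + 1 ≤ c * 2 × c * 2 < m + 1 + 2 →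
           (+ (l + m) ℤ.- + l) ℤ.* ceiling ((+ (l + m) ℤ.- + l ℤ.+ ℤ.1ℤ) / 2) ℤ.- ℤ.1ℤ ℤ.≤ + z
  bounds (c , ceiling≡c , _ , c*2<m+3) = begin
    (+ (l + m) ℤ.- + l) ℤ.* ceiling ((+ (l + m) ℤ.- + l ℤ.+ ℤ.1ℤ) / 2) ℤ.- ℤ.1ℤ
      ≡⟨ cong (λ x → x ℤ.* ceiling ((x ℤ.+ ℤ.1ℤ) / 2) ℤ.- ℤ.1ℤ) (+[m+n]-+m≡+n l m) ⟩
    + m ℤ.* ceiling (+ (m + 1) / 2) ℤ.- ℤ.1ℤ   ≡⟨ cong (λ x → + m ℤ.* x ℤ.- ℤ.1ℤ) ceiling≡c ⟩
    + m ℤ.* + c ℤ.- ℤ.1ℤ                        ≡⟨ cong (ℤ._- ℤ.1ℤ) (ℤ.pos-* m c) ⟨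
    + (m * c) ℤ.- ℤ.1ℤ                          ≤⟨ ℤ.+-monoˡ-≤ (ℤ.- ℤ.1ℤ) (ℤ.+≤+ mc≤1+z) ⟩
    + z                                         ∎
    where
    open ℤ.≤-Reasoning
    2c≤m+2 : 2 * c ≤ m + 2
    2c≤m+2 = subst (2 * c ≤_) (sym (+-suc m 1)) (c*2<a+2⇒2*c≤1+a {c = c} c*2<m+3)
    mc≤1+z : m * c ≤ suc z
    mc≤1+z = *-cancelˡ-≤ 2 (≤-trans (≤-reflexive (swap m c)) (≤-trans (*-monoʳ-≤ m 2c≤m+2) m[m+2]≤2[1+z]))
      where
      swap : ∀ m c → 2 * (m * c) ≡ m * (2 * c)
      swap = solve-∀

≤rhs-via-catalan : ∀ {p n l k} .{{_ : NonZero k}} → p ℚ.≤ ι (+ 3) ℚ.+ catSum l → p ℚ.≤ rhs n l k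
≤rhs-via-catalan {n = n} {l} {k} = ℚ.p≤q⇒p≤q⊔r
  (ι ((ℤ.1ℤ ℤ.+ (+ l ℤ.- ℤ.1ℤ) ℤ.* (+ n ℤ.- + k)) ℤ.* (ceiling (+ (k C l) / k) ℤ.- + l ℤ.+ + 2)))

catalan-case : ∀ {l n k} .{{_ : NonZero k}} → 5 ≤ l → l ≤ n → n ≤ 2 * (2 + l) → lhs n l ℚ.≤ rhs n l k
catalan-case {l@(suc (suc (suc (suc (suc t)))))} {n} (s≤s (s≤s (s≤s (s≤s (s≤s z≤n))))) l≤n n≤2[2+l] =
  ≤rhs-via-catalan {n = n} {l} (ℚ.≤-trans (lhs≤ι l m (3 + X) l+m≡n m[m+2]≤2[4+X]) ι[3+X]≤3+catSum)
  where
  X m : ℕ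
  X = (11 + t) C 2
  m = n ∸ l
  l+m≡n : l + m ≡ n
  l+m≡n = m+[n∸m]≡n l≤n

  m≤9+t : m ≤ 9 + t
  m≤9+t = +-cancelˡ-≤ l m (9 + t) (subst₂ _≤_ (sym l+m≡n) (eq t) n≤2[2+l])
    where
    eq : ∀ t → 2 * (7 + t) ≡ 5 + t + (9 + t)
    eq = solve-∀

  m[m+2]≤2[4+X] : m * (m + 2) ≤ 2 * (4 + X)
  m[m+2]≤2[4+X] = begin
    m * (m + 2)            ≤⟨ *-mono-≤ m≤9+t (+-monoˡ-≤ 2 m≤9+t) ⟩
    (9 + t) * (9 + t + 2)  ≡⟨ cong ((9 + t) *_) (+-comm (9 + t) 2) ⟩
    (9 + t) * (11 + t)     ≤⟨ *-monoˡ-≤ (11 + t) (n≤1+n (9 + t)) ⟩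
    (10 + t) * (11 + t)    ≡⟨ *-comm (10 + t) (11 + t) ⟩
    (11 + t) * (10 + t)    ≡⟨ 2*[1+n]C2≡[1+n]*n (10 + t) ⟨
    2 * X                  ≤⟨ *-monoʳ-≤ 2 (m≤n+m X 4) ⟩
    2 * (4 + X)            ∎
    where open ≤-Reasoning

  ι[3+X]≤3+catSum : ι (+ (3 + X)) ℚ.≤ ι (+ 3) ℚ.+ catSum l
  ι[3+X]≤3+catSum = subst (ℚ._≤ ι (+ 3) ℚ.+ catSum l) (sym (ι-homo-+ (+ 3) (+ X)))
                          (ℚ.+-monoʳ-≤ (ι (+ 3)) (catSum-lower-bound t))

[k-1][k-2]≤6⌈kCl/k⌉ : ∀ {x l c} → 3 ≤ l → l + 3 ≤ 2 + x → (2 + x) C l ≤ c * (2 + x) → (1 + x) * x ≤ 6 * c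
[k-1][k-2]≤6⌈kCl/k⌉ {x} {suc (suc (suc a))} {c} (s≤s (s≤s (s≤s z≤n))) l+3≤k kCl≤ck =
  *-cancelʳ-≤ ((1 + x) * x) (6 * c) (2 + x) (begin
    (1 + x) * x * (2 + x)       ≡⟨ reorder x ⟩
    (2 + x) * (1 + x) * x       ≡⟨ 6*[2+n]C3≡[2+n]*[1+n]*n x ⟨
    6 * ((2 + x) C 3)           ≤⟨ *-monoʳ-≤ 6 (nCs≤nC[s+a] 3 a (≤-trans (≤-reflexive (+-comm 3 (3 + a))) l+3≤k)) ⟩
    6 * ((2 + x) C (3 + a))     ≤⟨ *-monoʳ-≤ 6 kCl≤ck ⟩
    6 * (c * (2 + x))           ≡⟨ *-assoc 6 c (2 + x) ⟨
    6 * c * (2 + x)             ∎)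
  where
  open ≤-Reasoning
  reorder : ∀ x → (1 + x) * x * (2 + x) ≡ (2 + x) * (1 + x) * x
  reorder = solve-∀

slack-split : ∀ x s c A .{{_ : NonZero A}} → x + s * A ≤ c * A → s ≤ c × x ≤ (c ∸ s) * A
slack-split x s c A x+sA≤cA =
  *-cancelʳ-≤ s c A (≤-trans (m≤n+m (s * A) x) x+sA≤cA) ,
  subst (x ≤_) (sym (*-distribʳ-∸ A c s)) (m+n≤o⇒m≤o∸n x x+sA≤cA)

≤-by-certificate : ∀ {x y} e r → e ≤ 1 → x + (9 + r) ≡ y + 3 * (e * (e + 2)) → x ≤ y
≤-by-certificate {x} {y} e r e≤1 x+9+r≡ = +-cancelʳ-≤ 9 x y (begin
  x + 9                     ≤⟨ +-monoʳ-≤ x (m≤m+n 9 r) ⟩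
  x + (9 + r)               ≡⟨ x+9+r≡ ⟩
  y + 3 * (e * (e + 2))     ≤⟨ +-monoʳ-≤ y (*-monoʳ-≤ 3 (*-mono-≤ e≤1 (+-monoˡ-≤ 2 e≤1))) ⟩
  y + 9                     ∎)
  where open ≤-Reasoning

-- l = 3 + a, k = 6 + a + b, n − k = 5 + a + b + e, m = n − l and A = 1 + (l − 1)(n − k): then
-- 3m(m+2) + 6(l−2)A ≤ (k−1)(k−2)A. Adding 3e(e+2) − 9 ≤ 0 to the difference of the two sides
-- leaves a polynomial with nonnegative coefficients, which each certificate exhibits.
binomial-inequality : ∀ a b e → e ≤ 1 → 2 ≤ a ⊎ 2 ≤ a + b →
  3 * ((8 + a + 2 * b + e) * (8 + a + 2 * b + e + 2)) + 6 * (1 + a) * (1 + (2 + a) * (5 + a + b + e))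
    ≤ (5 + a + b) * (4 + a + b) * (1 + (2 + a) * (5 + a + b + e))
binomial-inequality (suc (suc a)) b e e≤1 _ = ≤-by-certificate e _ e≤1 (certificate a b e)
  where
  certificate : ∀ a b e →
    3 * ((8 + (2 + a) + 2 * b + e) * (8 + (2 + a) + 2 * b + e + 2)) + 6 * (1 + (2 + a)) * (1 + (2 + (2 + a)) * (5 + (2 + a) + b + e))
      + (9 + (327 + 36 * e + 341 * b + 401 * a + 40 * b * e + 69 * b * b + 46 * a * e + 241 * a * b + 127 * a * a
              + 4 * b * b * e + 4 * b * b * b + 21 * a * b * e + 32 * a * b * b + 11 * a * a * e + 46 * a * a * b
              + 18 * a * a * a + a * b * b * e + a * b * b * b + 2 * a * a * b * e + 3 * a * a * b * b + a * a * a * e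
              + 3 * a * a * a * b + a * a * a * a))
    ≡ (5 + (2 + a) + b) * (4 + (2 + a) + b) * (1 + (2 + (2 + a)) * (5 + (2 + a) + b + e)) + 3 * (e * (e + 2))
  certificate = solve-∀
binomial-inequality 0 (suc (suc b)) e e≤1 _ = ≤-by-certificate e _ e≤1 (certificate b e)
  where
  certificate : ∀ b e →
    3 * ((8 + 0 + 2 * (2 + b) + e) * (8 + 0 + 2 * (2 + b) + e + 2)) + 6 * (1 + 0) * (1 + (2 + 0) * (5 + 0 + (2 + b) + e))
      + (9 + (27 + 111 * b + 14 * b * e + 29 * b * b + 2 * b * b * e + 2 * b * b * b))
    ≡ (5 + 0 + (2 + b)) * (4 + 0 + (2 + b)) * (1 + (2 + 0) * (5 + 0 + (2 + b) + e)) + 3 * (e * (e + 2))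
  certificate = solve-∀
binomial-inequality 1 (suc b) e e≤1 _ = ≤-by-certificate e _ e≤1 (certificate b e)
  where
  certificate : ∀ b e →
    3 * ((8 + 1 + 2 * (1 + b) + e) * (8 + 1 + 2 * (1 + b) + e + 2)) + 6 * (1 + 1) * (1 + (2 + 1) * (5 + 1 + (1 + b) + e))
      + (9 + (222 + 24 * e + 232 * b + 27 * b * e + 49 * b * b + 3 * b * b * e + 3 * b * b * b))
    ≡ (5 + 1 + (1 + b)) * (4 + 1 + (1 + b)) * (1 + (2 + 1) * (5 + 1 + (1 + b) + e)) + 3 * (e * (e + 2))
  certificate = solve-∀
binomial-inequality 0 0             _ _ (inj₂ ())
binomial-inequality 0 1             _ _ (inj₂ (s≤s ()))
binomial-inequality 1 0             _ _ (inj₁ (s≤s ()))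
binomial-inequality 1 0             _ _ (inj₂ (s≤s ()))

≤rhs-via-binomial : ∀ {p k f s D} .{{_ : NonZero k}} → ceiling (+ (k C (2 + s)) / k) ≡ + (s + D) →
                    p ℚ.≤ ι (+ ((1 + (1 + s) * f) * D)) → p ℚ.≤ rhs (k + f) (2 + s) k
≤rhs-via-binomial {p} {k} {f} {s} {D} ceiling≡ p≤ = ℚ.p≤q⇒p≤r⊔q (ι (+ 3) ℚ.+ catSum (2 + s))
  (subst (p ℚ.≤_) (cong ι (sym second≡)) p≤)
  where
  open ≡-Reasoning
  cancel : ∀ i j → i ℤ.+ j ℤ.- (+ 2 ℤ.+ i) ℤ.+ + 2 ≡ j
  cancel = ℤ-Solver.solve-∀
  second≡ : (ℤ.1ℤ ℤ.+ (+ (2 + s) ℤ.- ℤ.1ℤ) ℤ.* (+ (k + f) ℤ.- + k)) ℤ.* (ceiling (+ (k C (2 + s)) / k) ℤ.- + (2 + s) ℤ.+ + 2)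
            ≡ + ((1 + (1 + s) * f) * D)
  second≡ = begin
    (ℤ.1ℤ ℤ.+ (+ (2 + s) ℤ.- ℤ.1ℤ) ℤ.* (+ (k + f) ℤ.- + k)) ℤ.* (ceiling (+ (k C (2 + s)) / k) ℤ.- + (2 + s) ℤ.+ + 2)
      ≡⟨ cong₂ (λ x y → (ℤ.1ℤ ℤ.+ x ℤ.* y) ℤ.* (ceiling (+ (k C (2 + s)) / k) ℤ.- + (2 + s) ℤ.+ + 2))
               (+[m+n]-+m≡+n 1 (1 + s)) (+[m+n]-+m≡+n k f) ⟩
    (ℤ.1ℤ ℤ.+ + (1 + s) ℤ.* + f) ℤ.* (ceiling (+ (k C (2 + s)) / k) ℤ.- + (2 + s) ℤ.+ + 2)
      ≡⟨ cong (λ x → (ℤ.1ℤ ℤ.+ + (1 + s) ℤ.* + f) ℤ.* (x ℤ.- + (2 + s) ℤ.+ + 2)) ceiling≡ ⟩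
    (ℤ.1ℤ ℤ.+ + (1 + s) ℤ.* + f) ℤ.* (+ (s + D) ℤ.- + (2 + s) ℤ.+ + 2)
      ≡⟨ cong₂ (λ x y → (ℤ.1ℤ ℤ.+ x) ℤ.* y) (ℤ.pos-* (1 + s) f) (sym (cancel (+ s) (+ D))) ⟨
    + (1 + (1 + s) * f) ℤ.* + D
      ≡⟨ ℤ.pos-* (1 + (1 + s) * f) D ⟨
    + ((1 + (1 + s) * f) * D) ∎

binomial-core : ∀ a b e {k n} .{{_ : NonZero k}} → e ≤ 1 → 2 ≤ a ⊎ 2 ≤ a + b →
                6 + a + b ≡ k → k + (5 + a + b + e) ≡ n → lhs n (3 + a) ℚ.≤ rhs n (3 + a) k
binomial-core a b e e≤1 small refl refl = from-ceiling (ceiling-/ (k C l) k)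
  where
  l k f m A : ℕ
  l = 3 + a
  k = 6 + a + b
  f = 5 + a + b + e
  m = 8 + a + 2 * b + e
  A = 1 + (2 + a) * f

  l+m≡k+f : l + m ≡ k + f
  l+m≡k+f = eq a b e
    where
    eq : ∀ a b e → 3 + a + (8 + a + 2 * b + e) ≡ 6 + a + b + (5 + a + b + e)
    eq = solve-∀

  from-ceiling : ∃[ c ] ceiling (+ (k C l) / k) ≡ + c × k C l ≤ c * k × c * k < k C l + k →
                 lhs (k + f) l ℚ.≤ rhs (k + f) l k
  from-ceiling (c , ceiling≡c , kCl≤ck , _) =
    ≤rhs-via-binomial {k = k} {f} {1 + a} (trans ceiling≡c (cong +_ (sym l-2+D≡c))) (lhs≤ι l m (A * D) l+m≡k+f m[m+2]≤2[1+AD])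
    where
    [k-1][k-2]≤6c : (5 + a + b) * (4 + a + b) ≤ 6 * c
    [k-1][k-2]≤6c = [k-1][k-2]≤6⌈kCl/k⌉ {c = c} (s≤s (s≤s (s≤s z≤n))) (≤-trans (≤-reflexive (eq a)) (m≤m+n (6 + a) b)) kCl≤ck
      where
      eq : ∀ a → 3 + a + 3 ≡ 6 + a
      eq = solve-∀

    split : 6 * (1 + a) ≤ 6 * c × 3 * (m * (m + 2)) ≤ (6 * c ∸ 6 * (1 + a)) * A
    split = slack-split _ _ _ A (≤-trans (binomial-inequality a b e e≤1 small) (*-monoˡ-≤ A [k-1][k-2]≤6c))

    D : ℕ
    D = c ∸ (1 + a)

    l-2+D≡c : 1 + a + D ≡ c
    l-2+D≡c = m+[n∸m]≡n {1 + a} {c} (*-cancelˡ-≤ 6 (proj₁ split))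

    m[m+2]≤2[1+AD] : m * (m + 2) ≤ 2 * suc (A * D)
    m[m+2]≤2[1+AD] = ≤-trans (*-cancelˡ-≤ 3 (subst (3 * (m * (m + 2)) ≤_) 6DA≡3[2AD] (proj₂ split)))
                             (*-monoʳ-≤ 2 (n≤1+n (A * D)))
      where
      6DA≡3[2AD] : (6 * c ∸ 6 * (1 + a)) * A ≡ 3 * (2 * (A * D))
      6DA≡3[2AD] = trans (cong (_* A) (sym (*-distribˡ-∸ 6 c (1 + a)))) (eq A D)
        where
        eq : ∀ A D → 6 * D * A ≡ 3 * (2 * (A * D))
        eq = solve-∀

binomial-case : ∀ {l k n} .{{_ : NonZero k}} → 3 ≤ l → 2 + l < k → n ≤ 2 * k → 2 * k ≤ suc n →
                5 ≤ l ⊎ 8 ≤ k → lhs n l ℚ.≤ rhs n l k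
binomial-case {suc (suc (suc a))} {k} {n} (s≤s (s≤s (s≤s z≤n))) 2+l<k n≤2k 2k≤1+n large =
  binomial-core a b e e≤1 small k≡ (trans (sym (+-assoc k F e)) k+F+e≡n)
  where
  b : ℕ
  b = k ∸ (6 + a)
  k≡ : 6 + a + b ≡ k
  k≡ = m+[n∸m]≡n 2+l<k
  F : ℕ
  F = 5 + a + b

  2k≡1+k+F : 2 * k ≡ suc (k + F)
  2k≡1+k+F = subst (λ k → 2 * k ≡ suc (k + F)) k≡ (eq a b)
    where
    eq : ∀ a b → 2 * (6 + a + b) ≡ suc (6 + a + b + (5 + a + b))
    eq = solve-∀

  e : ℕ
  e = n ∸ (k + F)
  k+F+e≡n : k + F + e ≡ n
  k+F+e≡n = m+[n∸m]≡n (≤-pred (subst (_≤ suc n) 2k≡1+k+F 2k≤1+n))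

  e≤1 : e ≤ 1
  e≤1 = +-cancelˡ-≤ (k + F) e 1 (subst₂ _≤_ (sym k+F+e≡n) (trans 2k≡1+k+F (+-comm 1 (k + F))) n≤2k)

  small : 2 ≤ a ⊎ 2 ≤ a + b
  small = map₂ (λ 8≤k → +-cancelˡ-≤ 6 2 (a + b) (subst (8 ≤_) (sym k≡) 8≤k))
               (map₁ (λ { (s≤s (s≤s (s≤s 2≤a))) → 2≤a }) large)

lemma4p4 : (l n : ℕ) → 3 ≤ l → 2 * l + 3 ≤ n → (5 ≤ l ⊎ 15 ≤ n) →
           (k : ℕ) → k ≡ halfCeil n → .{{_ : NonZero k}} →
           lhs n l ℚ.≤ rhs n l k
lemma4p4 l n 3≤l 2l+3≤n large k k≡ = [ binomial , catalan ]′ (m≤n⇒m<n∨m≡n 2+l≤k)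
  where
  n≤2k : n ≤ 2 * k
  n≤2k = proj₁ (halfCeil-bounds k≡)
  2k≤1+n : 2 * k ≤ suc n
  2k≤1+n = proj₂ (halfCeil-bounds k≡)

  8≤k : 15 ≤ n → 8 ≤ k
  8≤k 15≤n = *-cancelˡ-< 2 7 k (≤-trans 15≤n n≤2k)

  2+l≤k : 2 + l ≤ k
  2+l≤k = *-cancelˡ-< 2 (1 + l) k (subst (_≤ 2 * k) (eq l) (≤-trans 2l+3≤n n≤2k))
    where
    eq : ∀ l → 2 * l + 3 ≡ 1 + 2 * (1 + l)
    eq = solve-∀

  binomial : 2 + l < k → lhs n l ℚ.≤ rhs n l k
  binomial 2+l<k = binomial-case 3≤l 2+l<k n≤2k 2k≤1+n (map₂ 8≤k large)

  catalan : 2 + l ≡ k → lhs n l ℚ.≤ rhs n l k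
  catalan 2+l≡k = catalan-case 5≤l l≤n (subst (λ k → n ≤ 2 * k) (sym 2+l≡k) n≤2k)
    where
    l≤n : l ≤ n
    l≤n = ≤-trans (≤-trans (m≤n*m l 2) (m≤m+n (2 * l) 3)) 2l+3≤n
    5≤l : 5 ≤ l
    5≤l = [ id , (λ 15≤n → +-cancelˡ-≤ 2 5 l (≤-trans (n≤1+n 7) (subst (8 ≤_) (sym 2+l≡k) (8≤k 15≤n)))) ]′ large
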